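{- Let $S$ be a finite subset of $\mathbb{Z}\setminus\{0\}$. Let $a$ and $b$ be the largest nonnegative integers in $S\cup\{0\}$ and $-S\cup\{0\}$ respectively (where $-S=\{ -s:s\in S\}$), and let $c=a+b$. Then the domination ratio $\overline{\gamma}(\mathbb{Z},S)$ is achieved by some periodic dominating set $D$ of $\Gamma(\mathbb{Z},S)$ with period $p\le c2^c$, i.e. $\delta(D)=\overline{\gamma}(\mathbb{Z},S)$.
   Context: For $S\subseteq\mathbb{Z}\setminus\{0\}$, the digraph $\Gamma(\mathbb{Z},S)$ has vertex set $\mathbb{Z}$ and a directed edge $(g,g+s)$ for every $g\in\mathbb{Z}$, $s\in S$. A vertex $u$ dominates $v$ if $u=v$ or $(u,v)$ is an edge; $D\subseteq\mathbb{Z}$ is a dominating set if every integer is dominated by some element of $D$. The density of $U\subseteq\mathbb{Z}$ is $\delta(U)=\liminf_{n\to\infty}|U\cap[-n,n]|/(2n+1)$, and $\overline{\gamma}(\mathbb{Z},S)$ is the infimum of $\delta(D)$ over all dominating sets $D$. A set $U\subseteq\mathbb{Z}$ is periodic if there is a positive integer $d$ with $U\cap[id+1,id+d]=\{id+j: j\in U\cap[1,d]\}$ for all $i\in\mathbb{Z}$; the smallest such $d$ is the period of $U$. Here $[m,n]$ denotes $\{x\in\mathbb{Z}: m\le x\le n\}$. -}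

module Defs where

open import Data.Bool using (Bool; true; false; if_then_else_)
open import Data.Nat as ℕ using (ℕ; zero; suc; _⊔_)
open import Data.Integer as ℤ using (ℤ; +_; -[1+_]; -_)
open import Data.Rational as ℚ using (ℚ; 0ℚ)
open import Data.List using (List)
open import Data.List.Relation.Unary.All using (All)
open import Data.List.Membership.Propositional using (_∈_)
open import Data.Product using (Σ; ∃; _×_; _,_)
open import Data.Sum using (_⊎_)
open import Relation.Binary.PropositionalEquality using (_≡_; _≢_)

Subset : Set
Subset = ℤ → Bool

pos : ℤ → ℕ
pos (+ n) = n
pos -[1+ n ] = 0

aOf : List ℤ → ℕ
aOf Data.List.[] = 0
aOf (s Data.List.∷ S) = pos s ⊔ aOf S

bOf : List ℤ → ℕ
bOf Data.List.[] = 0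
bOf (s Data.List.∷ S) = pos (- s) ⊔ bOf S

Dominates : List ℤ → ℤ → ℤ → Set
Dominates S u v = (u ≡ v) ⊎ (∃ λ s → s ∈ S × v ≡ u ℤ.+ s)

IsDominating : List ℤ → Subset → Set
IsDominating S D = ∀ v → ∃ λ u → D u ≡ true × Dominates S u v

countFrom : Subset → ℤ → ℕ → ℕ
countFrom U m zero = 0
countFrom U m (suc k) = (if U m then 1 else 0) ℕ.+ countFrom U (m ℤ.+ ℤ.+ 1) k

ratio : Subset → ℕ → ℚ
ratio U n = ℚ._/_ (+ countFrom U (- (+ n)) (suc (2 ℕ.* n))) (suc (2 ℕ.* n))

LiminfGe : (ℕ → ℚ) → ℚ → Set
LiminfGe x q = ∀ (ε : ℚ) → 0ℚ ℚ.< ε → ∃ λ N → ∀ n → N ℕ.≤ n → q ℚ.- ε ℚ.< x n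

LiminfLe : (ℕ → ℚ) → ℚ → Set
LiminfLe x q = ∀ (ε : ℚ) → 0ℚ ℚ.< ε → ∀ N → ∃ λ n → N ℕ.≤ n × x n ℚ.< q ℚ.+ ε

DensityIs : Subset → ℚ → Set
DensityIs U q = LiminfGe (ratio U) q × LiminfLe (ratio U) q

DensityGe : Subset → ℚ → Set
DensityGe U q = LiminfGe (ratio U) q

IsPeriodicWith : Subset → ℕ → Set
IsPeriodicWith U d = ∀ (i : ℤ) (j : ℕ) → 1 ℕ.≤ j → j ℕ.≤ d →
  U (i ℤ.* + d ℤ.+ + j) ≡ U (+ j)

HasPeriod : Subset → ℕ → Set
HasPeriod U p = 1 ℕ.≤ p × IsPeriodicWith U p ×
  (∀ d → 1 ℕ.≤ d → IsPeriodicWith U d → p ℕ.≤ d)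

-- Whether a vertex v is dominated by D depends only on D ∩ [v − a, v + b], a window of c + 1
-- consecutive bits, so dominating sets are the Boolean sequences all of whose windows satisfy a
-- local condition. Among the cyclic patterns of period at most 2^c all of whose windows satisfy
-- it, fix one of least density W / P. In a locally valid sequence of length L > 2^c, two of the
-- first 2^c + 1 windows of length c coincide, at positions i < i + p ≤ 2^c; the block [i, i + p)
-- then closes up into a valid cyclic pattern, so it contains at least W p / P ones, and deleting
-- it leaves a shorter valid sequence. By induction W L ≤ P · #ones + W 2^c, so every dominating
-- set has density at least W / P, while the periodic extension of the optimal pattern attains it;
-- its least period is at most P ≤ 2^c ≤ c 2^c.
module Submission where

open import Defs
open import Data.Nat using (ℕ; _≤_; _+_; _*_; _^_)
open import Data.Integer using (ℤ)
open import Data.Rational using (ℚ)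
open import Data.List using (List; [])
open import Data.List.Relation.Unary.All using (All)
open import Data.Product using (∃; _×_)
open import Relation.Binary.PropositionalEquality using (_≡_; _≢_)

open import Algebra.Bundles using (AbelianGroup)
open import Data.Bool using (Bool; true; false; if_then_else_)
import Data.Bool.Properties as Bool
open import Data.Fin as Fin using (Fin; toℕ; fromℕ<; funToFin; finToFun)
import Data.Fin.Properties as Fin
open import Data.Integer as ℤ using (+_; -[1+_]; +<+; _⊖_; ∣_∣)
open import Data.Integer.DivMod using (_%ℕ_; _/ℕ_; n%ℕd<d; a≡a%ℕn+[a/ℕn]*n)
import Data.Integer.Properties as ℤ
import Data.Integer.Tactic.RingSolver as ℤ-Solver
open import Algebra.Properties.Group (AbelianGroup.group ℤ.+-0-abelianGroup) using (∙-cancelʳ; //-rightDividesˡ)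
open import Data.List using (_∷_; map; _++_; concatMap; upTo; filter)
open import Data.List.Membership.Propositional using (_∈_; find; lose)
open import Data.List.Membership.Propositional.Properties
  using (∈-map⁺; ∈-++⁺ˡ; ∈-++⁺ʳ; ∈-concatMap⁺; ∈-upTo⁺; ∈-filter⁺)
open import Data.List.Relation.Unary.All as All using (_∷_)
open import Data.List.Relation.Unary.All.Properties using (all-filter)
open import Data.List.Relation.Unary.Any using (here; there; any?)
open import Data.Nat
open import Data.Nat.DivMod using (_%_; _/_; m%n<n; m≡m%n+[m/n]*n; m<n⇒m%n≡m; [m+n]%n≡m%n)
open import Data.Nat.Induction using (<-wellFounded)
open import Data.Nat.Properties
open import Data.Nat.Tactic.RingSolver using (solve-∀)
open import Data.Product using (∃₂; _,_; proj₁; proj₂)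
open import Data.Rational as ℚ using (mkℚ; 0ℚ)
import Data.Rational.Properties as ℚ
open import Data.Rational.Unnormalised as ℚᵘ using (ℚᵘ; *≤*)
import Data.Rational.Unnormalised.Properties as ℚᵘ
open import Data.List.Extrema ℚᵘ.≤-totalOrder using (argmin; argmin-all; f[argmin]≤f[xs])
open import Data.Sum using (_⊎_; inj₁; inj₂; [_,_]′)
open import Function.Bundles using (Inverse)
open import Induction.WellFounded using (Acc; acc)
open import Relation.Binary.PropositionalEquality
open import Relation.Nullary.Decidable using (Dec; yes; no; _×-dec_; _⊎-dec_; map′)
open import Relation.Nullary.Negation using (¬_; contradiction)

-- Counting ones in Boolean sequences

shift : ℕ → (ℕ → Bool) → ℕ → Bool
shift k x t = x (k + t)

count : (ℕ → Bool) → ℕ → ℕ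
count x zero    = 0
count x (suc L) = (if x 0 then 1 else 0) + count (shift 1 x) L

count-cong : ∀ {x y} L → (∀ {t} → t < L → x t ≡ y t) → count x L ≡ count y L
count-cong zero    x≗y = refl
count-cong (suc L) x≗y =
  cong₂ _+_ (cong (λ b → if b then 1 else 0) (x≗y z<s)) (count-cong L (λ t<L → x≗y (s<s t<L)))

count-+ : ∀ x i L → count x (i + L) ≡ count x i + count (shift i x) L
count-+ x zero    L = refl
count-+ x (suc i) L =
  trans (cong (_+_ b) (count-+ (shift 1 x) i L)) (sym (+-assoc b _ _))
  where b = if x 0 then 1 else 0

count-+-+ : ∀ x i p m →
            count x (i + p + m) ≡ count x i + count (shift i x) p + count (shift (i + p) x) m
count-+-+ x i p m = trans (count-+ x (i + p) m) (cong (_+ count (shift (i + p) x) m) (count-+ x i p))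

count-mono : ∀ x {i L} → i ≤ L → count x i ≤ count x L
count-mono x {i} i≤L with m≤n⇒∃[o]m+o≡n i≤L
... | o , refl = subst (count x i ≤_) (sym (count-+ x i o)) (m≤m+n _ _)

module _ {P : ℕ} {x : ℕ → Bool} (periodic : ∀ t → x (P + t) ≡ x t) where

  count-periodic : ∀ q r → count x (q * P + r) ≡ q * count x P + count x r
  count-periodic zero    r = refl
  count-periodic (suc q) r = begin
    count x (P + q * P + r)                    ≡⟨ cong (count x) (+-assoc P (q * P) r) ⟩
    count x (P + (q * P + r))                  ≡⟨ count-+ x P (q * P + r) ⟩
    count x P + count (shift P x) (q * P + r)  ≡⟨ cong (_+_ W) (count-cong (q * P + r) λ {t} _ → periodic t) ⟩
    W + count x (q * P + r)                    ≡⟨ cong (_+_ W) (count-periodic q r) ⟩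
    W + (q * W + count x r)                    ≡⟨ +-assoc W (q * W) (count x r) ⟨
    suc q * W + count x r                      ∎
    where
    open ≡-Reasoning
    W = count x P

  count-periodic-≤ : .{{_ : NonZero P}} → ∀ L → P * count x L ≤ count x P * L + count x P * P
  count-periodic-≤ L = begin
    P * count x L                ≡⟨ cong (λ n → P * count x n) L≡qP+r ⟩
    P * count x (q * P + r)      ≡⟨ cong (P *_) (count-periodic q r) ⟩
    P * (q * W + count x r)      ≤⟨ *-monoʳ-≤ P (+-monoʳ-≤ (q * W) (count-mono x (<⇒≤ (m%n<n L P)))) ⟩
    P * (q * W + W)              ≡⟨ rearrange P q W ⟩
    W * (q * P) + W * P          ≤⟨ +-monoˡ-≤ (W * P) (*-monoʳ-≤ W qP≤L) ⟩
    W * L + W * P                ∎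
    where
    open ≤-Reasoning
    W = count x P
    q = L / P
    r = L % P
    L≡qP+r : L ≡ q * P + r
    L≡qP+r = trans (m≡m%n+[m/n]*n L P) (+-comm r (q * P))
    qP≤L : q * P ≤ L
    qP≤L = subst (q * P ≤_) (sym L≡qP+r) (m≤m+n (q * P) r)
    rearrange : ∀ P q W → P * (q * W + W) ≡ W * (q * P) + W * P
    rearrange = solve-∀

-- Repeated windows

windowCode : ∀ c → (ℕ → Bool) → ℕ → Fin (2 ^ c)
windowCode c x i = funToFin {c} {2} (λ j → Inverse.from Fin.2↔Bool (x (i + toℕ j)))

windowCode-injective : ∀ c x {i j} → windowCode c x i ≡ windowCode c x j →
                       ∀ {t} → t < c → x (i + t) ≡ x (j + t)
windowCode-injective c x {i} {j} eq {t} t<c = begin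
  x (i + t)                           ≡⟨ cong (λ s → x (i + s)) (Fin.toℕ-fromℕ< t<c) ⟨
  x (i + toℕ k)                       ≡⟨ decode i ⟨
  bitAt k (windowCode c x i)          ≡⟨ cong (bitAt k) eq ⟩
  bitAt k (windowCode c x j)          ≡⟨ decode j ⟩
  x (j + toℕ k)                       ≡⟨ cong (λ s → x (j + s)) (Fin.toℕ-fromℕ< t<c) ⟩
  x (j + t)                           ∎
  where
  open ≡-Reasoning
  open Inverse Fin.2↔Bool using (to; from; strictlyInverseˡ)
  k = fromℕ< t<c
  bitAt : Fin c → Fin (2 ^ c) → Bool
  bitAt l w = to (finToFun {2} {c} w l)
  decode : ∀ n → bitAt k (windowCode c x n) ≡ x (n + toℕ k)
  decode n = trans (cong to (Fin.finToFun-funToFin {c} (λ l → from (x (n + toℕ l))) k))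
                   (strictlyInverseˡ (x (n + toℕ k)))

window-pigeonhole : ∀ c x → ∃₂ λ i p′ → i + suc p′ ≤ 2 ^ c ×
                    (∀ {t} → t < c → x (i + t) ≡ x (i + (suc p′ + t)))
window-pigeonhole c x
  with i , j , i<j , same ← Fin.pigeonhole (n<1+n (2 ^ c)) (λ k → windowCode c x (toℕ k))
  with p′ , i+1+p′≡j ← m≤n⇒∃[o]m+o≡n i<j =
  toℕ i , p′ , subst (_≤ 2 ^ c) (sym i+p≡j) (s≤s⁻¹ (Fin.toℕ<n j)) ,
  λ {t} t<c → trans (windowCode-injective c x same t<c)
                    (cong x (trans (cong (_+ t) (sym i+p≡j)) (+-assoc (toℕ i) (suc p′) t)))
  where
  i+p≡j : toℕ i + suc p′ ≡ toℕ j
  i+p≡j = trans (+-suc (toℕ i) p′) i+1+p′≡j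

module _ {c p : ℕ} {z : ℕ → Bool} (repeats : ∀ {t} → t < c → z t ≡ z (p + t)) where

  repeats-multiple : ∀ q r → q * p + r < p + c → z r ≡ z (q * p + r)
  repeats-multiple zero    r _  = refl
  repeats-multiple (suc q) r lt = begin
    z r                  ≡⟨ repeats-multiple q r (<-≤-trans qp+r<c (m≤n+m c p)) ⟩
    z (q * p + r)        ≡⟨ repeats qp+r<c ⟩
    z (p + (q * p + r))  ≡⟨ cong z (+-assoc p (q * p) r) ⟨
    z (p + q * p + r)    ∎
    where
    open ≡-Reasoning
    qp+r<c : q * p + r < c
    qp+r<c = +-cancelˡ-< p (q * p + r) c (subst (_< p + c) (+-assoc p (q * p) r) lt)

  repeats-cyclic : .{{_ : NonZero p}} → ∀ {r} → r < p + c → z (r % p) ≡ z r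
  repeats-cyclic {r} r<p+c =
    trans (repeats-multiple (r / p) (r % p) (subst (_< p + c) r≡ r<p+c)) (cong z (sym r≡))
    where
    r≡ : r ≡ r / p * p + r % p
    r≡ = trans (m≡m%n+[m/n]*n r p) (+-comm (r % p) (r / p * p))

cutOut : ℕ → ℕ → (ℕ → Bool) → ℕ → Bool
cutOut i p x t with t <? i
... | yes _ = x t
... | no  _ = x (p + t)

module _ {i p : ℕ} {x : ℕ → Bool} where

  cutOut-< : ∀ {t} → t < i → cutOut i p x t ≡ x t
  cutOut-< {t} t<i with t <? i
  ... | yes _  = refl
  ... | no t≮i = contradiction t<i t≮i

  cutOut-≥ : ∀ {t} → i ≤ t → cutOut i p x t ≡ x (p + t)
  cutOut-≥ {t} i≤t with t <? i
  ... | yes t<i = contradiction i≤t (<⇒≱ t<i)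
  ... | no _    = refl

  count-cutOut : ∀ m → count (cutOut i p x) (i + m) ≡ count x i + count (shift (i + p) x) m
  count-cutOut m = trans (count-+ (cutOut i p x) i m)
    (cong₂ _+_ (count-cong i cutOut-<)
               (count-cong m (λ {t} _ → trans (cutOut-≥ (m≤m+n i t)) (cong x (swap i p t)))))
    where
    swap : ∀ i p t → p + (i + t) ≡ i + p + t
    swap = solve-∀

  cutOut-repeats : ∀ {c} → (∀ {t} → t < c → x (i + t) ≡ x (i + (p + t))) →
                   ∀ {s} → s < i + c → x s ≡ cutOut i p x s
  cutOut-repeats {c} repeats {s} s<i+c with <-≤-connex s i
  ... | inj₁ s<i = sym (cutOut-< s<i)
  ... | inj₂ i≤s with r , refl ← m≤n⇒∃[o]m+o≡n i≤s = begin
    x (i + r)             ≡⟨ repeats (+-cancelˡ-< i r c s<i+c) ⟩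
    x (i + (p + r))       ≡⟨ cong x (+-comm-middle i p r) ⟩
    x (p + (i + r))       ≡⟨ cutOut-≥ (m≤m+n i r) ⟨
    cutOut i p x (i + r)  ∎
    where
    open ≡-Reasoning
    +-comm-middle : ∀ i p r → i + (p + r) ≡ p + (i + r)
    +-comm-middle = solve-∀

-- Sequences covered by a local condition on windows

module WindowCovering (c : ℕ) (Good : (ℕ → Bool) → Set)
  (Good-local : ∀ {x y} → (∀ {t} → t ≤ c → x t ≡ y t) → Good x → Good y) where

  CoveredOn : (ℕ → Bool) → ℕ → Set
  CoveredOn x L = ∀ {k} → k < L → Good (shift k x)

  cyclic : (p : ℕ) .{{_ : NonZero p}} → (ℕ → Bool) → ℕ → Bool
  cyclic p y t = y (t % p)

  CyclicallyCovered : (p : ℕ) .{{_ : NonZero p}} → (ℕ → Bool) → Set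
  CyclicallyCovered p y = CoveredOn (cyclic p y) p

  module _ {x : ℕ → Bool} {i p : ℕ} (repeats : ∀ {t} → t < c → x (i + t) ≡ x (i + (p + t))) where

    covered-cycle : .{{_ : NonZero p}} → ∀ {L} → i + p ≤ L → CoveredOn x L → CyclicallyCovered p (shift i x)
    covered-cycle i+p≤L covered {k} k<p = Good-local agree (covered (≤-trans (+-monoʳ-< i k<p) i+p≤L))
      where
      agree : ∀ {t} → t ≤ c → x (i + k + t) ≡ x (i + (k + t) % p)
      agree {t} t≤c = trans (cong x (+-assoc i k t)) (sym (repeats-cyclic repeats (+-mono-<-≤ k<p t≤c)))

    covered-cutOut : ∀ m → CoveredOn x (i + p + m) → CoveredOn (cutOut i p x) (i + m)
    covered-cutOut m covered {k} k<i+m with <-≤-connex k i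
    ... | inj₁ k<i = Good-local (λ t≤c → cutOut-repeats repeats (+-mono-<-≤ k<i t≤c))
                             (covered (<-≤-trans k<i (≤-trans (m≤m+n i p) (m≤m+n (i + p) m))))
    ... | inj₂ i≤k = Good-local agree (covered p+k<i+p+m)
      where
      agree : ∀ {t} → t ≤ c → x (p + k + t) ≡ cutOut i p x (k + t)
      agree {t} _ = trans (cong x (+-assoc p k t)) (sym (cutOut-≥ (≤-trans i≤k (m≤m+n k t))))
      p+k<i+p+m : p + k < i + p + m
      p+k<i+p+m = subst (p + k <_) (shuffle i p m) (+-monoʳ-< p k<i+m)
        where
        shuffle : ∀ i p m → p + (i + m) ≡ i + p + m
        shuffle = solve-∀

  CyclicDensity≥ : ℕ → ℕ → Set
  CyclicDensity≥ W P =
    ∀ p′ y → suc p′ ≤ 2 ^ c → CyclicallyCovered (suc p′) y → W * suc p′ ≤ P * count y (suc p′)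

  module _ {W P : ℕ} (optimal : CyclicDensity≥ W P) where

    covered-count-≥ : ∀ {L} → Acc _<_ L → ∀ x → CoveredOn x L → W * L ≤ P * count x L + W * 2 ^ c
    covered-count-≥ {L} (acc rec) x covered with L ≤? 2 ^ c
    ... | yes L≤B = ≤-trans (*-monoʳ-≤ W L≤B) (m≤n+m (W * 2 ^ c) (P * count x L))
    ... | no L≰B
      with i , p′ , i+p≤B , repeats ← window-pigeonhole c x
      with m , refl ← m≤n⇒∃[o]m+o≡n (≤-trans i+p≤B (<⇒≤ (≰⇒> L≰B))) = begin
        W * (i + p + m)                      ≡⟨ split-length W i p m ⟩
        W * (i + m) + W * p                  ≤⟨ +-mono-≤ rest cycle ⟩
        P * (X + Z) + W * 2 ^ c + P * Y      ≡⟨ regroup P X Y Z (W * 2 ^ c) ⟩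
        P * (X + Y + Z) + W * 2 ^ c          ≡⟨ cong (λ n → P * n + W * 2 ^ c) (count-+-+ x i p m) ⟨
        P * count x (i + p + m) + W * 2 ^ c  ∎
      where
      open ≤-Reasoning
      p = suc p′
      X = count x i
      Y = count (shift i x) p
      Z = count (shift (i + p) x) m
      rest : W * (i + m) ≤ P * (X + Z) + W * 2 ^ c
      rest = subst (λ n → W * (i + m) ≤ P * n + W * 2 ^ c) (count-cutOut {i} {p} {x} m)
        (covered-count-≥ (rec (+-monoˡ-< m (m<m+n i z<s))) (cutOut i p x)
          (covered-cutOut {x} {i} {p} repeats m covered))
      cycle : W * p ≤ P * Y
      cycle = optimal p′ (shift i x) (≤-trans (m≤n+m p i) i+p≤B)
                (covered-cycle {x} {i} {p} repeats (m≤m+n (i + p) m) covered)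
      split-length : ∀ W i p m → W * (i + p + m) ≡ W * (i + m) + W * p
      split-length = solve-∀
      regroup : ∀ P X Y Z K → P * (X + Z) + K + P * Y ≡ P * (X + Y + Z) + K
      regroup = solve-∀

  module Optimum (good? : ∀ x → Dec (Good x)) (good-ones : Good (λ _ → true)) where

    prepend : Bool → (ℕ → Bool) → ℕ → Bool
    prepend b y zero    = b
    prepend b y (suc t) = y t

    patterns : ℕ → List (ℕ → Bool)
    patterns zero    = (λ _ → false) ∷ []
    patterns (suc n) = map (prepend false) (patterns n) ++ map (prepend true) (patterns n)

    prepend-∈ : ∀ b {n g} → g ∈ patterns n → prepend b g ∈ patterns (suc n)
    prepend-∈ false g∈ = ∈-++⁺ˡ (∈-map⁺ (prepend false) g∈)
    prepend-∈ true {n} g∈ = ∈-++⁺ʳ (map (prepend false) (patterns n)) (∈-map⁺ (prepend true) g∈)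

    patterns-complete : ∀ n y → ∃ λ g → g ∈ patterns n × (∀ {t} → t < n → g t ≡ y t)
    patterns-complete zero    y = _ , here refl , λ ()
    patterns-complete (suc n) y with g , g∈ , g≗y ← patterns-complete n (shift 1 y) =
      prepend (y 0) g , prepend-∈ (y 0) {n} g∈ , agree
      where
      agree : ∀ {t} → t < suc n → prepend (y 0) g t ≡ y t
      agree {zero}  _         = refl
      agree {suc t} (s<s t<n) = g≗y t<n

    -- (p′ , y) stands for the cyclic pattern t ↦ y (t % suc p′).
    Candidate : Set
    Candidate = ℕ × (ℕ → Bool)

    candidates : ℕ → List Candidate
    candidates n = concatMap (λ p′ → map (p′ ,_) (patterns (suc p′))) (upTo n)

    Admissible : Candidate → Set
    Admissible (p′ , y) = suc p′ ≤ 2 ^ c × CyclicallyCovered (suc p′) y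

    admissible? : ∀ z → Dec (Admissible z)
    admissible? (p′ , y) = suc p′ ≤? 2 ^ c ×-dec allUpTo? (λ k → good? (shift k (cyclic (suc p′) y))) (suc p′)

    density : Candidate → ℚᵘ
    density (p′ , y) = + count y (suc p′) ℚᵘ./ suc p′

    -- Abstract, so that type checking never unfolds the exhaustive search.
    abstract
      optimum : Candidate
      optimum = argmin density (0 , λ _ → true) (filter admissible? (candidates (2 ^ c)))

      optimum-admissible : Admissible optimum
      optimum-admissible =
        argmin-all density {0 , λ _ → true} (m^n>0 2 c , λ {_} _ → good-ones)
          (all-filter admissible? (candidates (2 ^ c)))

      optimum-minimal : ∀ p′ y → Admissible (p′ , y) → density optimum ℚᵘ.≤ density (p′ , y)
      optimum-minimal p′ y (p≤B , covered) with g , g∈ , g≗y ← patterns-complete (suc p′) y =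
        subst (λ n → density optimum ℚᵘ.≤ + n ℚᵘ./ suc p′) (count-cong (suc p′) g≗y)
          (All.lookup (f[argmin]≤f[xs] _ _) (∈-filter⁺ admissible? candidate∈ (p≤B , covered′)))
        where
        candidate∈ : (p′ , g) ∈ candidates (2 ^ c)
        candidate∈ = ∈-concatMap⁺ (λ p′ → map (p′ ,_) (patterns (suc p′)))
                       (lose (∈-upTo⁺ p≤B) (∈-map⁺ (p′ ,_) g∈))
        covered′ : CyclicallyCovered (suc p′) g
        covered′ {k} k<p = Good-local (λ {t} _ → sym (g≗y (m%n<n (k + t) (suc p′)))) (covered k<p)

    P′ = proj₁ optimum
    P = suc P′
    g = proj₂ optimum
    W = count g P

    optimum-count-≥ : ∀ L x → CoveredOn x L → W * L ≤ P * count x L + W * 2 ^ c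
    optimum-count-≥ L = covered-count-≥ {W} {P} optimal (<-wellFounded L)
      where
      optimal : CyclicDensity≥ W P
      optimal p′ y p≤B covered with *≤* le ← optimum-minimal p′ y (p≤B , covered) =
        subst₂ _≤_ refl (*-comm (count y (suc p′)) P)
          (ℤ.drop‿+≤+ (subst₂ ℤ._≤_ (sym (ℤ.pos-* W (suc p′))) (sym (ℤ.pos-* (count y (suc p′)) P)) le))

-- Densities

positive-fraction : ∀ {ε} → 0ℚ ℚ.< ε → ∃₂ λ e f → ε ≡ + suc e ℚ./ suc f
positive-fraction {ε@(mkℚ (+ suc e) f _)} _ = e , f , sym (ℚ.fromℚᵘ-toℚᵘ ε)
positive-fraction {mkℚ (+ zero) _ _} (ℚ.*<* (+<+ ()))
positive-fraction {mkℚ -[1+ _ ] _ _} (ℚ.*<* ())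

<-+⇒-< : ∀ {p q ε} → p ℚ.< q ℚ.+ ε → p ℚ.- ε ℚ.< q
<-+⇒-< {p} {q} {ε} p<q+ε = ℚ.<-respʳ-≡ cancel (ℚ.+-monoˡ-< (ℚ.- ε) p<q+ε)
  where
  cancel : q ℚ.+ ε ℚ.- ε ≡ q
  cancel = trans (ℚ.+-assoc q ε (ℚ.- ε)) (trans (cong (λ z → q ℚ.+ z) (ℚ.+-inverseʳ ε)) (ℚ.+-identityʳ q))

fraction-< : ∀ a b c d e f .{{_ : NonZero b}} .{{_ : NonZero d}} .{{_ : NonZero f}} →
             a * (d * f) < (c * f + e * d) * b →
             + a ℚ./ b ℚ.< + c ℚ./ d ℚ.+ + e ℚ./ f
fraction-< a b@(suc _) c d@(suc _) e f@(suc _) lt = ℚ.toℚᵘ-cancel-<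
  (ℚᵘ.<-respˡ-≃ (ℚᵘ.≃-sym (ℚ.toℚᵘ-fromℚᵘ A))
  (ℚᵘ.<-respʳ-≃ (ℚᵘ.≃-sym (ℚᵘ.≃-trans (ℚ.toℚᵘ-homo-+ (+ c ℚ./ d) (+ e ℚ./ f))
                                          (ℚᵘ.+-cong (ℚ.toℚᵘ-fromℚᵘ C) (ℚ.toℚᵘ-fromℚᵘ E))))
  core))
  where
  A = + a ℚᵘ./ b
  C = + c ℚᵘ./ d
  E = + e ℚᵘ./ f
  core : A ℚᵘ.< C ℚᵘ.+ E
  core = ℚᵘ.*<* (subst₂ ℤ._<_ (ℤ.pos-* a (d * f)) rhs (+<+ lt))
    where
    rhs : + ((c * f + e * d) * b) ≡ (+ c ℤ.* + f ℤ.+ + e ℤ.* + d) ℤ.* + b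
    rhs = trans (ℤ.pos-* (c * f + e * d) b) (cong (ℤ._* + b)
            (trans (ℤ.pos-+ (c * f) (e * d)) (cong₂ ℤ._+_ (ℤ.pos-* c f) (ℤ.pos-* e d))))

absorb-constant : ∀ {X f L} Y K m .{{_ : NonZero m}} → X ≤ Y + K → K * f < L →
        X * f < Y * f + m * L
absorb-constant {X} {f} {L} Y K m X≤Y+K Kf<L = begin-strict
  X * f          ≤⟨ *-monoˡ-≤ f X≤Y+K ⟩
  (Y + K) * f    ≡⟨ *-distribʳ-+ f Y K ⟩
  Y * f + K * f  <⟨ +-monoʳ-< (Y * f) Kf<L ⟩
  Y * f + L      ≤⟨ +-monoʳ-≤ (Y * f) (m≤n*m L m) ⟩
  Y * f + m * L  ∎
  where open ≤-Reasoning

module _ {W P K : ℕ} .{{_ : NonZero P}} (x : ℕ → ℕ) where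

  private
    len : ℕ → ℕ
    len n = suc (2 * n)

    len-large : ∀ {M n} → M ≤ n → M < len n
    len-large M≤n = s≤s (≤-trans M≤n (m≤m+n _ _))

  liminf-ratio-≥ : (∀ n → W * len n ≤ P * x n + K) →
                   LiminfGe (λ n → + x n ℚ./ len n) (+ W ℚ./ P)
  liminf-ratio-≥ bound ε 0<ε with e , f , refl ← positive-fraction 0<ε =
    K * suc f , λ n Kf≤n → <-+⇒-< (fraction-< W P (x n) (len n) (suc e) (suc f)
      (subst₂ _<_ (lhs W (len n) (suc f)) (rhs P (x n) (suc f) (suc e) (len n))
        (absorb-constant (P * x n) K (suc e * P) {{m*n≢0 (suc e) P}} (bound n) (len-large Kf≤n))))
    where
    lhs : ∀ W L f → W * L * f ≡ W * (L * f)
    lhs = solve-∀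
    rhs : ∀ P x f e L → P * x * f + e * P * L ≡ (x * f + e * L) * P
    rhs = solve-∀

  liminf-ratio-≤ : (∀ n → P * x n ≤ W * len n + K) →
                   LiminfLe (λ n → + x n ℚ./ len n) (+ W ℚ./ P)
  liminf-ratio-≤ bound ε 0<ε N with e , f , refl ← positive-fraction 0<ε =
    n , m≤m+n N _ , fraction-< (x n) (len n) W P (suc e) (suc f)
      (subst₂ _<_ (lhs P (x n) (suc f)) (rhs W (len n) (suc f) (suc e) P)
        (absorb-constant (W * len n) K (suc e * P) {{m*n≢0 (suc e) P}} (bound n) (len-large (m≤n+m (K * suc f) N))))
    where
    n = N + K * suc f
    lhs : ∀ P x f → P * x * f ≡ x * (P * f)
    lhs = solve-∀
    rhs : ∀ W L f e P → W * L * f + e * P * L ≡ (W * f + e * P) * L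
    rhs = solve-∀

-- Remainders and least periods

remainder-unique : ∀ {P r r′} (q q′ : ℤ) → r < P → r′ < P →
                   + r ℤ.+ q ℤ.* + P ≡ + r′ ℤ.+ q′ ℤ.* + P → r ≡ r′
remainder-unique {P} {r} {r′} q q′ r<P r′<P eq = ℤ.+-injective (ℤ.i-j≡0⇒i≡j (+ r) (+ r′) r-r′≡0)
  where
  difference : ∀ x y q q′ P → x ℤ.+ q ℤ.* P ≡ y ℤ.+ q′ ℤ.* P → x ℤ.- y ≡ (q′ ℤ.- q) ℤ.* P
  difference x y q q′ P eq = begin
    x ℤ.- y                                  ≡⟨ add-sub x y (q ℤ.* P) ⟩
    x ℤ.+ q ℤ.* P ℤ.- (y ℤ.+ q ℤ.* P)        ≡⟨ cong (ℤ._- (y ℤ.+ q ℤ.* P)) eq ⟩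
    y ℤ.+ q′ ℤ.* P ℤ.- (y ℤ.+ q ℤ.* P)       ≡⟨ sub-distrib y q q′ P ⟩
    (q′ ℤ.- q) ℤ.* P                         ∎
    where
    open ≡-Reasoning
    add-sub : ∀ x y z → x ℤ.- y ≡ x ℤ.+ z ℤ.- (y ℤ.+ z)
    add-sub = ℤ-Solver.solve-∀
    sub-distrib : ∀ y q q′ P → y ℤ.+ q′ ℤ.* P ℤ.- (y ℤ.+ q ℤ.* P) ≡ (q′ ℤ.- q) ℤ.* P
    sub-distrib = ℤ-Solver.solve-∀
  r-r′≡[q′-q]P : + r ℤ.- + r′ ≡ (q′ ℤ.- q) ℤ.* + P
  r-r′≡[q′-q]P = difference (+ r) (+ r′) q q′ (+ P) eq
  ∣q′-q∣≡0 : ∣ q′ ℤ.- q ∣ ≡ 0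
  ∣q′-q∣≡0 = n<1⇒n≡0 (*-cancelʳ-< P (∣ q′ ℤ.- q ∣) 1 (begin-strict
    ∣ q′ ℤ.- q ∣ * P      ≡⟨ ℤ.abs-* (q′ ℤ.- q) (+ P) ⟨
    ∣ (q′ ℤ.- q) ℤ.* + P ∣   ≡⟨ cong ∣_∣ (trans (sym r-r′≡[q′-q]P) (ℤ.m-n≡m⊖n r r′)) ⟩
    ∣ r ⊖ r′ ∣               ≤⟨ ℤ.∣m⊝n∣≤m⊔n r r′ ⟩
    r ⊔ r′                 <⟨ ⊔-lub r<P r′<P ⟩
    P                       ≡⟨ +-identityʳ P ⟨
    1 * P                 ∎))
    where open ≤-Reasoning
  r-r′≡0 : + r ℤ.- + r′ ≡ + 0
  r-r′≡0 = trans r-r′≡[q′-q]P (cong (ℤ._* + P) (ℤ.∣i∣≡0⇒i≡0 {q′ ℤ.- q} ∣q′-q∣≡0))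

%ℕ-periodic : ∀ z q P .{{_ : NonZero P}} → (z ℤ.+ q ℤ.* + P) %ℕ P ≡ z %ℕ P
%ℕ-periodic z q P = remainder-unique (w /ℕ P) (z /ℕ P ℤ.+ q) (n%ℕd<d w P) (n%ℕd<d z P) (begin
    + (w %ℕ P) ℤ.+ w /ℕ P ℤ.* + P         ≡⟨ a≡a%ℕn+[a/ℕn]*n w P ⟨
    z ℤ.+ q ℤ.* + P                       ≡⟨ cong (ℤ._+ q ℤ.* + P) (a≡a%ℕn+[a/ℕn]*n z P) ⟩
    + r ℤ.+ z /ℕ P ℤ.* + P ℤ.+ q ℤ.* + P  ≡⟨ regroup (+ r) (z /ℕ P) q (+ P) ⟩
    + r ℤ.+ (z /ℕ P ℤ.+ q) ℤ.* + P        ∎)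
  where
  open ≡-Reasoning
  w = z ℤ.+ q ℤ.* + P
  r = z %ℕ P
  regroup : ∀ r d q P → r ℤ.+ d ℤ.* P ℤ.+ q ℤ.* P ≡ r ℤ.+ (d ℤ.+ q) ℤ.* P
  regroup = ℤ-Solver.solve-∀

countFrom≡count : ∀ U m L → countFrom U m L ≡ count (λ t → U (m ℤ.+ + t)) L
countFrom≡count U m zero    = refl
countFrom≡count U m (suc L) = cong₂ _+_
  (cong (λ z → if U z then 1 else 0) (sym (ℤ.+-identityʳ m)))
  (trans (countFrom≡count U (m ℤ.+ + 1) L) (count-cong L (λ {t} _ → cong U (ℤ.+-assoc m (+ 1) (+ t)))))

aOf-≥ : ∀ {s S} → s ∈ S → pos s ≤ aOf S
aOf-≥ (here refl)          = m≤m⊔n _ _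
aOf-≥ {S = s′ ∷ _} (there s∈) = ≤-trans (aOf-≥ s∈) (m≤n⊔m (pos s′) _)

bOf-≥ : ∀ {s S} → s ∈ S → pos (ℤ.- s) ≤ bOf S
bOf-≥ (here refl)          = m≤m⊔n _ _
bOf-≥ {S = s′ ∷ _} (there s∈) = ≤-trans (bOf-≥ s∈) (m≤n⊔m (pos (ℤ.- s′)) _)

least-below : ∀ {Q : ℕ → Set} → (∀ n → Dec (Q n)) → ∀ n →
              (∀ {k} → k < n → ¬ Q k) ⊎ ∃ λ m → m < n × Q m × (∀ {k} → k < m → ¬ Q k)
least-below Q? zero = inj₁ λ ()
least-below Q? (suc n) with least-below Q? n
... | inj₂ (m , m<n , Qm , below) = inj₂ (m , m<n⇒m<1+n m<n , Qm , below)
... | inj₁ none with Q? n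
...   | yes Qn = inj₂ (n , ≤-refl , Qn , none)
...   | no ¬Qn = inj₁ λ k<1+n → [ none , (λ { refl → ¬Qn }) ]′ (m<1+n⇒m<n∨m≡n k<1+n)

least : ∀ {Q : ℕ → Set} → (∀ n → Dec (Q n)) → ∀ {n} → Q n →
        ∃ λ m → m ≤ n × Q m × (∀ {k} → k < m → ¬ Q k)
least Q? {n} Qn with least-below Q? (suc n)
... | inj₁ none = contradiction Qn (none ≤-refl)
... | inj₂ (m , m<1+n , Qm , below) = m , s≤s⁻¹ m<1+n , Qm , below

least-period : ∀ {U} → (∀ d → Dec (IsPeriodicWith U d)) → ∀ {n} → 1 ≤ n → IsPeriodicWith U n →
               ∃ λ p → p ≤ n × HasPeriod U p
least-period periodic? 1≤n periodic-n
  with p , p≤n , (1≤p , periodic) , below ← least (λ d → (1 ≤? d) ×-dec periodic? d) (1≤n , periodic-n) =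
  p , p≤n , 1≤p , periodic , λ d 1≤d periodic-d → ≮⇒≥ (λ d<p → below d<p (1≤d , periodic-d))

-- Domination in Γ(ℤ, S)

module Domination (S : List ℤ) where

  a b c : ℕ
  a = aOf S
  b = bOf S
  c = a + b

  Offset : ℕ → Set
  Offset t = t ≡ a ⊎ ∃ λ s → s ∈ S × + t ℤ.+ s ≡ + a

  -- Reading x t as membership of w + t in D, Dominated x says that w + a is dominated
  -- from within [w, w + c].
  Dominated : (ℕ → Bool) → Set
  Dominated x = ∃ λ t → t ≤ c × Offset t × x t ≡ true

  Dominated-local : ∀ {x y} → (∀ {t} → t ≤ c → x t ≡ y t) → Dominated x → Dominated y
  Dominated-local x≗y (t , t≤c , offset , xt) = t , t≤c , offset , trans (sym (x≗y t≤c)) xt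

  dominated? : ∀ x → Dec (Dominated x)
  dominated? x =
    map′ (λ (t , t<1+c , rest) → t , s≤s⁻¹ t<1+c , rest) (λ (t , t≤c , rest) → t , s≤s t≤c , rest)
      (anyUpTo? (λ t → offset? t ×-dec (x t Bool.≟ true)) (suc c))
    where
    offset? : ∀ t → Dec (Offset t)
    offset? t =
      (t ≟ a) ⊎-dec map′ find (λ (s , s∈ , eq) → lose s∈ eq) (any? (λ s → (+ t ℤ.+ s) ℤ.≟ + a) S)

  ones-dominated : Dominated (λ _ → true)
  ones-dominated = a , m≤m+n a b , inj₁ refl , refl

  open WindowCovering c Dominated Dominated-local public
  open Optimum dominated? ones-dominated public

  offset-of : ∀ {s} → s ∈ S → ∃ λ t → t ≤ c × + t ℤ.+ s ≡ + a
  offset-of {+ n} s∈ =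
    a ∸ n , ≤-trans (m∸n≤m a n) (m≤m+n a b) ,
    trans (sym (ℤ.pos-+ (a ∸ n) n)) (cong +_ (m∸n+n≡m (aOf-≥ s∈)))
  offset-of { -[1+ n ]} s∈ = a + suc n , +-monoʳ-≤ a (bOf-≥ s∈) , (begin
    + (a + suc n) ℤ.+ -[1+ n ]        ≡⟨ cong (ℤ._+ -[1+ n ]) (ℤ.pos-+ a (suc n)) ⟩
    + a ℤ.+ + suc n ℤ.+ -[1+ n ]      ≡⟨ ℤ.+-assoc (+ a) (+ suc n) -[1+ n ] ⟩
    + a ℤ.+ (+ suc n ℤ.+ -[1+ n ])    ≡⟨ cong (λ z → + a ℤ.+ z) (ℤ.+-inverseʳ (+ suc n)) ⟩
    + a ℤ.+ + 0                       ≡⟨ ℤ.+-identityʳ (+ a) ⟩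
    + a                               ∎)
    where open ≡-Reasoning

  offset-dominates : ∀ w {t} → Offset t → Dominates S (w ℤ.+ + t) (w ℤ.+ + a)
  offset-dominates w (inj₁ refl) = inj₁ refl
  offset-dominates w {t} (inj₂ (s , s∈ , t+s≡a)) =
    inj₂ (s , s∈ , trans (cong (ℤ._+_ w) (sym t+s≡a)) (sym (ℤ.+-assoc w (+ t) s)))

  dominates-offset : ∀ w {u} → Dominates S u (w ℤ.+ + a) → ∃ λ t → t ≤ c × Offset t × w ℤ.+ + t ≡ u
  dominates-offset w (inj₁ refl) = a , m≤m+n a b , inj₁ refl , refl
  dominates-offset w {u} (inj₂ (s , s∈ , w+a≡u+s)) with t , t≤c , t+s≡a ← offset-of s∈ =
    t , t≤c , inj₂ (s , s∈ , t+s≡a) ,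
    ∙-cancelʳ s (w ℤ.+ + t) u (trans (ℤ.+-assoc w (+ t) s) (trans (cong (ℤ._+_ w) t+s≡a) w+a≡u+s))

  dominating⇒covered : ∀ {D} → IsDominating S D → ∀ m L → CoveredOn (λ t → D (m ℤ.+ + t)) L
  dominating⇒covered {D} dominating m L {k} _
    with u , Du , u→v ← dominating (m ℤ.+ + k ℤ.+ + a)
    with t , t≤c , offset , m+k+t≡u ← dominates-offset (m ℤ.+ + k) u→v =
    t , t≤c , offset , trans (cong D m+[k+t]≡u) Du
    where
    m+[k+t]≡u : m ℤ.+ + (k + t) ≡ u
    m+[k+t]≡u = trans (cong (ℤ._+_ m) (ℤ.pos-+ k t)) (trans (sym (ℤ.+-assoc m (+ k) (+ t))) m+k+t≡u)

  optimalSet : Subset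
  optimalSet z = g (z %ℕ P)

  optimalSet-periodic : ∀ z q → optimalSet (z ℤ.+ q ℤ.* + P) ≡ optimalSet z
  optimalSet-periodic z q = cong g (%ℕ-periodic z q P)

  optimalSet-window : ∀ m t → optimalSet (m ℤ.+ + t) ≡ cyclic P g (m %ℕ P + t)
  optimalSet-window m t = trans (cong optimalSet m+t≡) (optimalSet-periodic (+ (r + t)) q)
    where
    r = m %ℕ P
    q = m /ℕ P
    m+t≡ : m ℤ.+ + t ≡ + (r + t) ℤ.+ q ℤ.* + P
    m+t≡ = begin
      m ℤ.+ + t                         ≡⟨ cong (ℤ._+ + t) (a≡a%ℕn+[a/ℕn]*n m P) ⟩
      + r ℤ.+ q ℤ.* + P ℤ.+ + t         ≡⟨ swap (+ r) (q ℤ.* + P) (+ t) ⟩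
      + r ℤ.+ + t ℤ.+ q ℤ.* + P         ≡⟨ cong (ℤ._+ q ℤ.* + P) (ℤ.pos-+ r t) ⟨
      + (r + t) ℤ.+ q ℤ.* + P           ∎
      where
      open ≡-Reasoning
      swap : ∀ x y z → x ℤ.+ y ℤ.+ z ≡ x ℤ.+ z ℤ.+ y
      swap = ℤ-Solver.solve-∀

  optimalSet-dominates-shifted : ∀ w → ∃ λ u → optimalSet u ≡ true × Dominates S u (w ℤ.+ + a)
  optimalSet-dominates-shifted w with t , _ , offset , gt ← proj₂ optimum-admissible (n%ℕd<d w P) =
    w ℤ.+ + t , trans (optimalSet-window w t) gt , offset-dominates w offset

  optimalSet-dominating : IsDominating S optimalSet
  optimalSet-dominating v = subst (λ v → ∃ λ u → optimalSet u ≡ true × Dominates S u v)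
    (//-rightDividesˡ (+ a) v) (optimalSet-dominates-shifted (v ℤ.- + a))

  count-cyclic : count (cyclic P g) P ≡ W
  count-cyclic = count-cong P (λ t<P → cong g (m<n⇒m%n≡m t<P))

  cyclic-periodic : ∀ t → cyclic P g (P + t) ≡ cyclic P g t
  cyclic-periodic t = cong g (trans (cong (_% P) (+-comm P t)) ([m+n]%n≡m%n t P))

  optimalSet-count-≤ : ∀ m L → P * countFrom optimalSet m L ≤ W * L + W * (P + P)
  optimalSet-count-≤ m L = begin
    P * countFrom optimalSet m L           ≡⟨ cong (P *_) (countFrom≡count optimalSet m L) ⟩
    P * count (λ t → optimalSet (m ℤ.+ + t)) L
                                           ≡⟨ cong (P *_) (count-cong L (λ {t} _ → optimalSet-window m t)) ⟩
    P * count (shift r y) L                ≤⟨ *-monoʳ-≤ P (m≤n+m (count (shift r y) L) (count y r)) ⟩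
    P * (count y r + count (shift r y) L)  ≡⟨ cong (P *_) (count-+ y r L) ⟨
    P * count y (r + L)                    ≤⟨ count-periodic-≤ cyclic-periodic (r + L) ⟩
    count y P * (r + L) + count y P * P    ≡⟨ cong (λ w → w * (r + L) + w * P) count-cyclic ⟩
    W * (r + L) + W * P                    ≤⟨ +-monoˡ-≤ (W * P) (*-monoʳ-≤ W (+-monoˡ-≤ L r≤P)) ⟩
    W * (P + L) + W * P                    ≡⟨ rearrange W P L ⟩
    W * L + W * (P + P)                    ∎
    where
    open ≤-Reasoning
    y = cyclic P g
    r = m %ℕ P
    r≤P : r ≤ P
    r≤P = <⇒≤ (n%ℕd<d m P)
    rearrange : ∀ W P L → W * (P + L) + W * P ≡ W * L + W * (P + P)
    rearrange = solve-∀

  dominating-count-≥ : ∀ {D} → IsDominating S D → ∀ m L → W * L ≤ P * countFrom D m L + W * 2 ^ c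
  dominating-count-≥ {D} dominating m L = subst (λ n → W * L ≤ P * n + W * 2 ^ c) (sym (countFrom≡count D m L))
    (optimum-count-≥ L (λ t → D (m ℤ.+ + t)) (dominating⇒covered dominating m L))

  periodic? : ∀ d → Dec (IsPeriodicWith optimalSet d)
  periodic? d = map′ check⇒periodic periodic⇒check
    (allUpTo? (λ r → allUpTo? (λ j → optimalSet (+ r ℤ.* + d ℤ.+ + suc j) Bool.≟ optimalSet (+ suc j)) d) P)
    where
    Check : Set
    Check = ∀ {r} → r < P → ∀ {j} → j < d → optimalSet (+ r ℤ.* + d ℤ.+ + suc j) ≡ optimalSet (+ suc j)
    check⇒periodic : Check → IsPeriodicWith optimalSet d
    check⇒periodic check i (suc j) _ 1+j≤d = begin
      optimalSet (i ℤ.* + d ℤ.+ + suc j)                                  ≡⟨ cong optimalSet split ⟩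
      optimalSet (+ r ℤ.* + d ℤ.+ + suc j ℤ.+ q ℤ.* + d ℤ.* + P)
        ≡⟨ optimalSet-periodic (+ r ℤ.* + d ℤ.+ + suc j) (q ℤ.* + d) ⟩
      optimalSet (+ r ℤ.* + d ℤ.+ + suc j)                                ≡⟨ check (n%ℕd<d i P) 1+j≤d ⟩
      optimalSet (+ suc j)                                                ∎
      where
      open ≡-Reasoning
      r = i %ℕ P
      q = i /ℕ P
      regroup : ∀ r q P d j → (r ℤ.+ q ℤ.* P) ℤ.* d ℤ.+ j ≡ r ℤ.* d ℤ.+ j ℤ.+ q ℤ.* d ℤ.* P
      regroup = ℤ-Solver.solve-∀
      split : i ℤ.* + d ℤ.+ + suc j ≡ + r ℤ.* + d ℤ.+ + suc j ℤ.+ q ℤ.* + d ℤ.* + P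
      split = trans (cong (λ i → i ℤ.* + d ℤ.+ + suc j) (a≡a%ℕn+[a/ℕn]*n i P))
                    (regroup (+ r) q (+ P) (+ d) (+ suc j))
    periodic⇒check : IsPeriodicWith optimalSet d → Check
    periodic⇒check periodic {r} _ {j} j<d = periodic (+ r) (suc j) (s≤s z≤n) j<d

  optimalSet-periodicWith : IsPeriodicWith optimalSet P
  optimalSet-periodicWith i j _ _ = trans (cong optimalSet (ℤ.+-comm (i ℤ.* + P) (+ j))) (optimalSet-periodic (+ j) i)

  optimalSet-period : ∃ λ p → p ≤ P × HasPeriod optimalSet p
  optimalSet-period = least-period {optimalSet} periodic? (s≤s z≤n) optimalSet-periodicWith

1≤a+b : ∀ S → All (λ s → s ≢ + 0) S → S ≢ [] → 1 ≤ aOf S + bOf S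
1≤a+b []             _            S≢[] = contradiction refl S≢[]
1≤a+b (+ zero ∷ _)   (s≢0 ∷ _)    _    = contradiction refl s≢0
1≤a+b (+ suc n ∷ S)  _            _    = <-≤-trans z<s (≤-trans (m≤m⊔n (suc n) (aOf S)) (m≤m+n _ _))
1≤a+b (-[1+ n ] ∷ S) _            _    = <-≤-trans z<s (≤-trans (m≤m⊔n (suc n) (bOf S)) (m≤n+m _ _))

proposition1p3 : (S : List ℤ) → All (λ s → s ≢ Data.Integer.+ 0) S → S ≢ [] →
    ∃ λ (D : Subset) → ∃ λ (p : ℕ) → ∃ λ (q : ℚ) →
      IsDominating S D × HasPeriod D p ×
      p ≤ (aOf S + bOf S) * 2 ^ (aOf S + bOf S) ×
      DensityIs D q ×
      (∀ (D′ : Subset) → IsDominating S D′ → DensityGe D′ q)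
proposition1p3 S nonzero nonempty =
  let p , p≤P , period = optimalSet-period in
  optimalSet , p , + W ℚ./ P , optimalSet-dominating , period ,
  ≤-trans p≤P (≤-trans (proj₁ optimum-admissible) 2^c≤c*2^c) ,
  (density-≥ optimalSet-dominating , density-≤) ,
  λ _ → density-≥
  where
  open Domination S
  2^c≤c*2^c : 2 ^ c ≤ c * 2 ^ c
  2^c≤c*2^c = m≤n*m (2 ^ c) c {{>-nonZero (1≤a+b S nonzero nonempty)}}
  density-≥ : ∀ {D} → IsDominating S D → DensityGe D (+ W ℚ./ P)
  density-≥ dominating =
    liminf-ratio-≥ {W} {P} {W * 2 ^ c} _ (λ n → dominating-count-≥ dominating (ℤ.- + n) (suc (2 * n)))
  density-≤ : LiminfLe (ratio optimalSet) (+ W ℚ./ P)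
  density-≤ = liminf-ratio-≤ {W} {P} {W * (P + P)} _ (λ n → optimalSet-count-≤ (ℤ.- + n) (suc (2 * n)))
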